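{- Let $Y_0 = \lambda f.\,\omega_f\,\omega_f$ with $\omega_f = \lambda x.\,f(xx)$, let $B = \lambda xyz.\,x(yz)$ and $S = \lambda xyz.\,xz(yz)$. Then $B\,Y_0$ and $B\,Y_0\,S$ are not $\beta$-convertible.
   Context: Untyped $\lambda$-calculus with $\beta$-reduction; application associates to the left. -}

module Defs where

open import Data.Nat using (ℕ; zero; suc)
open import Data.Bool using (true; false)
open import Data.Nat using (_<ᵇ_; _≡ᵇ_)
open import Relation.Binary.Construct.Closure.Equivalence using (EqClosure)

-- Untyped λ-terms with de Bruijn indices (index 0 = innermost binder).
data Term : Set where
  var : ℕ → Term
  ƛ_  : Term → Term
  _·_ : Term → Term → Term

infixl 7 _·_
infixr 6 ƛ_

shift : ℕ → Term → Term
shift k (var n) with n <ᵇ k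
... | true  = var n
... | false = var (suc n)
shift k (ƛ t)   = ƛ shift (suc k) t
shift k (t · u) = shift k t · shift k u

-- subst k s t : substitute s for index k in t, and decrement indices > k
-- (the standard de Bruijn β-substitution t[k := s]).
subst : ℕ → Term → Term → Term
subst k s (var n) with n <ᵇ k | n ≡ᵇ k
... | true  | _     = var n
... | false | true  = s
... | false | false = var (pred n)
  where
  pred : ℕ → ℕ
  pred zero    = zero
  pred (suc m) = m
subst k s (ƛ t)   = ƛ subst (suc k) (shift 0 s) t
subst k s (t · u) = subst k s t · subst k s u

data _→β_ : Term → Term → Set where
  β    : ∀ {t u} → (ƛ t) · u →β subst 0 u t
  appL : ∀ {t t' u} → t →β t' → t · u →β t' · u
  appR : ∀ {t u u'} → u →β u' → t · u →β t · u'
  lam  : ∀ {t t'} → t →β t' → ƛ t →β ƛ t'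

infix 4 _→β_ _=β_

_=β_ : Term → Term → Set
_=β_ = EqClosure _→β_

-- Combinators.
-- ω_f = λx. f (x x), with f free (index 1 under the λx binder, inside λf).
-- Y₀ = λf. ω_f ω_f
Y₀ : Term
Y₀ = ƛ ((ƛ var 1 · (var 0 · var 0)) · (ƛ var 1 · (var 0 · var 0)))

B : Term
B = ƛ ƛ ƛ var 2 · (var 1 · var 0)

S : Term
S = ƛ ƛ ƛ var 2 · var 0 · (var 1 · var 0)

module Submission where

-- By Church–Rosser, a conversion B Y₀ =β B Y₀ S would give a
-- common reduct w.  We separate the two sides by an invariant of reduction
-- on each side:
--   * every reduct of B Y₀ S has type σ in a small recursive type system
--     (twelve types, each with at most one arrow decomposition, one of them
--     being D = D → T, which types the self application x x inside Y₀);
--     this holds because B Y₀ S is typable and typing is closed under β;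
--   * the reducts of B Y₀ form an explicitly described family (the body of
--     Y₀ unfolds to f (f (… (ω_f ω_f)))), and no member of it has type σ.

open import Defs
open import Data.Bool using (true; false)
open import Data.Empty using (⊥-elim)
open import Data.Nat using (ℕ; zero; suc; _<_; _≤_; z≤n; s≤s; _<ᵇ_; _≡ᵇ_)
open import Data.Nat.Properties using (<-cmp; ≤-refl; ≤-trans; <⇒≤; n≤1+n; ≤-<-trans; <-irrefl)
open import Data.Product using (Σ; _×_; _,_)
open import Relation.Binary using (Tri; tri<; tri≈; tri>)
open import Relation.Binary.Construct.Closure.ReflexiveTransitive using (Star; ε; _◅_; _◅◅_)
open import Relation.Binary.Construct.Closure.Symmetric using (fwd; bwd)
open import Relation.Binary.PropositionalEquality using (_≡_; refl; sym; trans; cong; cong₂)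
open import Relation.Nullary using (¬_)

<⇒<ᵇ≡true : ∀ {n k} → n < k → (n <ᵇ k) ≡ true
<⇒<ᵇ≡true (s≤s z≤n) = refl
<⇒<ᵇ≡true (s≤s (s≤s p)) = <⇒<ᵇ≡true (s≤s p)

≥⇒<ᵇ≡false : ∀ {n k} → k ≤ n → (n <ᵇ k) ≡ false
≥⇒<ᵇ≡false z≤n = refl
≥⇒<ᵇ≡false (s≤s p) = ≥⇒<ᵇ≡false p

≡ᵇ-refl : ∀ k → (k ≡ᵇ k) ≡ true
≡ᵇ-refl zero = refl
≡ᵇ-refl (suc k) = ≡ᵇ-refl k

>⇒≡ᵇ≡false : ∀ {m k} → k ≤ m → (suc m ≡ᵇ k) ≡ false
>⇒≡ᵇ≡false z≤n = refl
>⇒≡ᵇ≡false (s≤s p) = >⇒≡ᵇ≡false p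

shift-var< : ∀ {n k} → n < k → shift k (var n) ≡ var n
shift-var< p rewrite <⇒<ᵇ≡true p = refl

shift-var≥ : ∀ {n k} → k ≤ n → shift k (var n) ≡ var (suc n)
shift-var≥ p rewrite ≥⇒<ᵇ≡false p = refl

subst-var< : ∀ {n k s} → n < k → subst k s (var n) ≡ var n
subst-var< p rewrite <⇒<ᵇ≡true p = refl

subst-var≡ : ∀ {k s} → subst k s (var k) ≡ s
subst-var≡ {k} rewrite ≥⇒<ᵇ≡false (≤-refl {k}) | ≡ᵇ-refl k = refl

subst-var> : ∀ {m k s} → k ≤ m → subst k s (var (suc m)) ≡ var m
subst-var> {m} p rewrite ≥⇒<ᵇ≡false (≤-trans p (n≤1+n m)) | >⇒≡ᵇ≡false p = refl

subst-shift : ∀ i s t → subst i s (shift i t) ≡ t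
subst-shift i s (var n) with <-cmp n i
... | tri< p _ _ rewrite shift-var< p = subst-var< p
... | tri≈ _ refl _ rewrite shift-var≥ (≤-refl {n}) = subst-var> ≤-refl
... | tri> _ _ p rewrite shift-var≥ (<⇒≤ p) = subst-var> (<⇒≤ p)
subst-shift i s (ƛ t) = cong ƛ_ (subst-shift (suc i) (shift 0 s) t)
subst-shift i s (t · u) = cong₂ _·_ (subst-shift i s t) (subst-shift i s u)

shift-shift : ∀ {i k} → i ≤ k → ∀ u → shift (suc k) (shift i u) ≡ shift i (shift k u)
shift-shift {i} {k} ik (var n) with <-cmp n i
... | tri< p _ _ rewrite shift-var< p | shift-var< (≤-trans p ik) | shift-var< p
                       | shift-var< (≤-trans p (≤-trans ik (n≤1+n k))) = refl
... | tri≈ _ refl _ = at-i (<-cmp n k)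
  where
  at-i : Tri (n < k) (n ≡ k) (k < n) → shift (suc k) (shift n (var n)) ≡ shift n (shift k (var n))
  at-i (tri< r _ _) rewrite shift-var≥ (≤-refl {n}) | shift-var< r | shift-var< (s≤s r)
                          | shift-var≥ (≤-refl {n}) = refl
  at-i (tri≈ _ refl _) rewrite shift-var≥ (≤-refl {n}) | shift-var≥ (≤-refl {suc n})
                             | shift-var≥ (n≤1+n n) = refl
  at-i (tri> _ _ r) = ⊥-elim (<-irrefl refl (≤-<-trans ik r))
... | tri> _ _ p with <-cmp n k
... | tri< r _ _ rewrite shift-var≥ (<⇒≤ p) | shift-var< (s≤s r) | shift-var< r
                       | shift-var≥ (<⇒≤ p) = refl
... | tri≈ _ refl _ rewrite shift-var≥ (<⇒≤ p) | shift-var≥ (≤-refl {suc n})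
                          | shift-var≥ (≤-refl {n}) | shift-var≥ (≤-trans (<⇒≤ p) (n≤1+n n)) = refl
... | tri> _ _ r rewrite shift-var≥ (<⇒≤ p) | shift-var≥ (s≤s (<⇒≤ r)) | shift-var≥ (<⇒≤ r)
                       | shift-var≥ (≤-trans (<⇒≤ p) (n≤1+n n)) = refl
shift-shift ik (ƛ u) = cong ƛ_ (shift-shift (s≤s ik) u)
shift-shift ik (t · u) = cong₂ _·_ (shift-shift ik t) (shift-shift ik u)

shift-above-subst : ∀ {i k} → i ≤ k → ∀ u t →
                    shift k (subst i u t) ≡ subst i (shift k u) (shift (suc k) t)
shift-above-subst {i} {k} ik u (var n) with <-cmp n i
... | tri< p _ _ rewrite subst-var< {s = u} p | shift-var< (≤-trans p ik)
                       | shift-var< {n} {suc k} (≤-trans p (≤-trans ik (n≤1+n k)))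
                       | subst-var< {s = shift k u} p = refl
... | tri≈ _ refl _ rewrite subst-var≡ {n} {u} | shift-var< {n} {suc k} (s≤s ik)
                          | subst-var≡ {n} {shift k u} = refl
... | tri> _ _ (s≤s {n = m} p) with <-cmp m k
...   | tri< r _ _ rewrite subst-var> {s = u} p | shift-var< r | shift-var< {suc m} {suc k} (s≤s r)
                         | subst-var> {s = shift k u} p = refl
...   | tri≈ _ refl _ rewrite subst-var> {s = u} p | shift-var≥ (≤-refl {m})
                            | shift-var≥ (≤-refl {suc m})
                            | subst-var> {s = shift m u} (≤-trans p (n≤1+n m)) = refl
...   | tri> _ _ r rewrite subst-var> {s = u} p | shift-var≥ (<⇒≤ r) | shift-var≥ (s≤s (<⇒≤ r))
                         | subst-var> {s = shift k u} (≤-trans p (n≤1+n m)) = refl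
shift-above-subst {k = k} ik u (ƛ t)
  rewrite shift-above-subst (s≤s ik) (shift 0 u) t | shift-shift {k = k} z≤n u = refl
shift-above-subst ik u (t · t') = cong₂ _·_ (shift-above-subst ik u t) (shift-above-subst ik u t')

shift-below-subst : ∀ {j k} → j ≤ k → ∀ u t →
                    shift j (subst k u t) ≡ subst (suc k) (shift j u) (shift j t)
shift-below-subst {j} {k} jk u (var n) with <-cmp n k
... | tri< p _ _ with <-cmp n j
...   | tri< r _ _ rewrite subst-var< {s = u} p | shift-var< r
                         | subst-var< {s = shift j u} (≤-trans p (n≤1+n k)) = refl
...   | tri≈ _ refl _ rewrite subst-var< {s = u} p | shift-var≥ (≤-refl {n})
                            | subst-var< {s = shift n u} (s≤s p) = refl
...   | tri> _ _ r rewrite subst-var< {s = u} p | shift-var≥ (<⇒≤ r)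
                         | subst-var< {s = shift j u} (s≤s p) = refl
shift-below-subst {j} {k} jk u (var n) | tri≈ _ refl _
  rewrite subst-var≡ {n} {u} | shift-var≥ jk | subst-var≡ {suc n} {shift j u} = refl
shift-below-subst {j} {k} jk u (var n) | tri> _ _ (s≤s {n = m} p)
  rewrite subst-var> {s = u} p | shift-var≥ (≤-trans jk p)
        | shift-var≥ (≤-trans jk (≤-trans p (n≤1+n m))) | subst-var> {s = shift j u} (s≤s p) = refl
shift-below-subst {j} jk u (ƛ t)
  rewrite shift-below-subst (s≤s jk) (shift 0 u) t | shift-shift {k = j} z≤n u = refl
shift-below-subst jk u (t · t') = cong₂ _·_ (shift-below-subst jk u t) (shift-below-subst jk u t')

subst-subst : ∀ {i k} → i ≤ k → ∀ u s t →
              subst k u (subst i s t) ≡ subst i (subst k u s) (subst (suc k) (shift i u) t)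
subst-subst {i} {k} ik u s (var n) with <-cmp n i
... | tri< p _ _ rewrite subst-var< {s = s} p | subst-var< {s = u} (≤-trans p ik)
                       | subst-var< {s = shift i u} (≤-trans p (≤-trans ik (n≤1+n k)))
                       | subst-var< {s = subst k u s} p = refl
... | tri≈ _ refl _ rewrite subst-var≡ {n} {s} | subst-var< {s = shift n u} (s≤s ik)
                          | subst-var≡ {n} {subst k u s} = refl
... | tri> _ _ (s≤s {n = m} p) with <-cmp m k
...   | tri< r _ _ rewrite subst-var> {s = s} p | subst-var< {s = u} r
                         | subst-var< {s = shift i u} (s≤s r) | subst-var> {s = subst k u s} p = refl
...   | tri≈ _ refl _ rewrite subst-var> {s = s} p | subst-var≡ {m} {u}
                            | subst-var≡ {suc m} {shift i u} | subst-shift i (subst m u s) u = refl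
subst-subst {i} {k} ik u s (var (suc (suc q))) | tri> _ _ (s≤s p) | tri> _ _ (s≤s r)
  rewrite subst-var> {s = s} p | subst-var> {s = u} r | subst-var> {s = shift i u} (s≤s r)
        | subst-var> {s = subst k u s} (≤-trans ik r) = refl
subst-subst {i} {k} ik u s (ƛ t)
  rewrite subst-subst (s≤s ik) (shift 0 u) (shift 0 s) t | shift-shift {k = i} z≤n u
        | shift-below-subst {k = k} z≤n u s = refl
subst-subst ik u s (t · t') = cong₂ _·_ (subst-subst ik u s t) (subst-subst ik u s t')

-- Confluence (Tait–Martin-Löf parallel reduction, Takahashi's method)

infix 4 _⇒_ _⇒*_ _↠_

data _⇒_ : Term → Term → Set where
  pvar : ∀ {n} → var n ⇒ var n
  plam : ∀ {t t'} → t ⇒ t' → ƛ t ⇒ ƛ t'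
  papp : ∀ {t t' u u'} → t ⇒ t' → u ⇒ u' → t · u ⇒ t' · u'
  pβ   : ∀ {t t' u u'} → t ⇒ t' → u ⇒ u' → (ƛ t) · u ⇒ subst 0 u' t'

_⇒*_ : Term → Term → Set
_⇒*_ = Star _⇒_

_↠_ : Term → Term → Set
_↠_ = Star _→β_

⇒-refl : ∀ t → t ⇒ t
⇒-refl (var n) = pvar
⇒-refl (ƛ t) = plam (⇒-refl t)
⇒-refl (t · u) = papp (⇒-refl t) (⇒-refl u)

⇒-shift : ∀ k {t t'} → t ⇒ t' → shift k t ⇒ shift k t'
⇒-shift k (pvar {n}) = ⇒-refl (shift k (var n))
⇒-shift k (plam p) = plam (⇒-shift (suc k) p)
⇒-shift k (papp p q) = papp (⇒-shift k p) (⇒-shift k q)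
⇒-shift k (pβ {t' = t'} {u' = u'} p q)
  rewrite shift-above-subst {0} {k} z≤n u' t' = pβ (⇒-shift (suc k) p) (⇒-shift k q)

⇒-subst : ∀ k {t t' s s'} → t ⇒ t' → s ⇒ s' → subst k s t ⇒ subst k s' t'
⇒-subst k {s = s} {s' = s'} (pvar {n}) q with <-cmp n k
... | tri< r _ _ rewrite subst-var< {n} {k} {s} r | subst-var< {n} {k} {s'} r = pvar
... | tri≈ _ refl _ rewrite subst-var≡ {k} {s} | subst-var≡ {k} {s'} = q
... | tri> _ _ (s≤s {n = m} r) rewrite subst-var> {m} {k} {s} r | subst-var> {m} {k} {s'} r = pvar
⇒-subst k (plam p) q = plam (⇒-subst (suc k) p (⇒-shift 0 q))
⇒-subst k (papp p p') q = papp (⇒-subst k p q) (⇒-subst k p' q)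
⇒-subst k {s' = s'} (pβ {t' = t'} {u' = u'} p p') q
  rewrite subst-subst {0} {k} z≤n s' u' t' = pβ (⇒-subst (suc k) p (⇒-shift 0 q)) (⇒-subst k p' q)

develop : Term → Term
develop (var n) = var n
develop (ƛ t) = ƛ develop t
develop (var n · u) = var n · develop u
develop ((ƛ t) · u) = subst 0 (develop u) (develop t)
develop ((t · t') · u) = develop (t · t') · develop u

⇒-develop : ∀ {t t'} → t ⇒ t' → t' ⇒ develop t
⇒-develop pvar = pvar
⇒-develop (plam p) = plam (⇒-develop p)
⇒-develop (papp {t = var n} p q) = papp (⇒-develop p) (⇒-develop q)
⇒-develop (papp {t = ƛ t} (plam p) q) = pβ (⇒-develop p) (⇒-develop q)
⇒-develop (papp {t = t₁ · t₂} p q) = papp (⇒-develop p) (⇒-develop q)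
⇒-develop (pβ p q) = ⇒-subst 0 (⇒-develop p) (⇒-develop q)

strip : ∀ {t t₁ t₂} → t ⇒ t₁ → t ⇒* t₂ → Σ Term λ w → (t₁ ⇒* w) × (t₂ ⇒ w)
strip {t₁ = t₁} p ε = t₁ , ε , p
strip p (q ◅ qs) with strip (⇒-develop q) qs
... | w , a , b = w , (⇒-develop p ◅ a) , b

⇒*-confluent : ∀ {t t₁ t₂} → t ⇒* t₁ → t ⇒* t₂ → Σ Term λ w → (t₁ ⇒* w) × (t₂ ⇒* w)
⇒*-confluent {t₂ = t₂} ε qs = t₂ , qs , ε
⇒*-confluent (p ◅ ps) qs with strip p qs
... | w , a , b with ⇒*-confluent ps a
...   | v , c , d = v , c , (b ◅ d)

↠-lam : ∀ {t t'} → t ↠ t' → ƛ t ↠ ƛ t'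
↠-lam ε = ε
↠-lam (p ◅ ps) = lam p ◅ ↠-lam ps

↠-app : ∀ {t t' u u'} → t ↠ t' → u ↠ u' → t · u ↠ t' · u'
↠-app ε ε = ε
↠-app ε (q ◅ qs) = appR q ◅ ↠-app ε qs
↠-app (p ◅ ps) qs = appL p ◅ ↠-app ps qs

→β⇒⇒ : ∀ {t t'} → t →β t' → t ⇒ t'
→β⇒⇒ (β {t} {u}) = pβ (⇒-refl t) (⇒-refl u)
→β⇒⇒ (appL {u = u} p) = papp (→β⇒⇒ p) (⇒-refl u)
→β⇒⇒ (appR {t = t} p) = papp (⇒-refl t) (→β⇒⇒ p)
→β⇒⇒ (lam p) = plam (→β⇒⇒ p)

⇒⇒↠ : ∀ {t t'} → t ⇒ t' → t ↠ t'
⇒⇒↠ pvar = ε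
⇒⇒↠ (plam p) = ↠-lam (⇒⇒↠ p)
⇒⇒↠ (papp p q) = ↠-app (⇒⇒↠ p) (⇒⇒↠ q)
⇒⇒↠ (pβ p q) = ↠-app (↠-lam (⇒⇒↠ p)) (⇒⇒↠ q) ◅◅ (β ◅ ε)

↠⇒⇒* : ∀ {t t'} → t ↠ t' → t ⇒* t'
↠⇒⇒* ε = ε
↠⇒⇒* (p ◅ ps) = →β⇒⇒ p ◅ ↠⇒⇒* ps

⇒*⇒↠ : ∀ {t t'} → t ⇒* t' → t ↠ t'
⇒*⇒↠ ε = ε
⇒*⇒↠ (p ◅ ps) = ⇒⇒↠ p ◅◅ ⇒*⇒↠ ps

↠-confluent : ∀ {t t₁ t₂} → t ↠ t₁ → t ↠ t₂ → Σ Term λ w → (t₁ ↠ w) × (t₂ ↠ w)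
↠-confluent p q with ⇒*-confluent (↠⇒⇒* p) (↠⇒⇒* q)
... | w , a , b = w , ⇒*⇒↠ a , ⇒*⇒↠ b

church-rosser : ∀ {x y} → x =β y → Σ Term λ w → (x ↠ w) × (y ↠ w)
church-rosser {x} ε = x , ε , ε
church-rosser (fwd p ◅ rest) with church-rosser rest
... | z , a , b = z , (p ◅ a) , b
church-rosser (bwd p ◅ rest) with church-rosser rest
... | z , a , b with ↠-confluent (p ◅ ε) a
...   | w , c , d = w , c , (b ◅◅ d)

-- Type assignment over a type structure with unique arrow decompositions

-- Types are the elements of an arbitrary set Ty; Arrow A B C says that A
-- is (one way of seeing it as) the arrow type B → C.  Types may be
-- recursive.  Subject reduction needs only that each type has at most one
-- arrow decomposition.
module TypeAssignment
  {Ty : Set} (Arrow : Ty → Ty → Ty → Set)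
  (arrow-unique : ∀ {A B C B' C'} → Arrow A B C → Arrow A B' C' → (B ≡ B') × (C ≡ C'))
  where

  Ctx : Set
  Ctx = ℕ → Ty

  infixl 5 _,,_

  _,,_ : Ctx → Ty → Ctx
  (Γ ,, B) zero = B
  (Γ ,, B) (suc i) = Γ i

  -- insert k B Γ: the context matching shift k, with B placed at index k.
  insert : ℕ → Ty → Ctx → Ctx
  insert zero B Γ = Γ ,, B
  insert (suc k) B Γ = insert k B (λ i → Γ (suc i)) ,, Γ zero

  infix 4 _⊢_∶_

  data _⊢_∶_ (Γ : Ctx) : Term → Ty → Set where
    tvar : ∀ {n A} → Γ n ≡ A → Γ ⊢ var n ∶ A
    tlam : ∀ {A B C t} → Arrow A B C → Γ ,, B ⊢ t ∶ C → Γ ⊢ ƛ t ∶ A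
    tapp : ∀ {A B C t u} → Arrow A B C → Γ ⊢ t ∶ A → Γ ⊢ u ∶ B → Γ ⊢ t · u ∶ C

  insert-< : ∀ {n k B Γ} → n < k → insert k B Γ n ≡ Γ n
  insert-< {zero} {suc k} (s≤s p) = refl
  insert-< {suc n} {suc k} (s≤s p) = insert-< {n} {k} p

  insert-≡ : ∀ {k B Γ} → insert k B Γ k ≡ B
  insert-≡ {zero} = refl
  insert-≡ {suc k} = insert-≡ {k}

  insert-> : ∀ {n k B Γ} → k ≤ n → insert k B Γ (suc n) ≡ Γ n
  insert-> {n} {zero} p = refl
  insert-> {suc n} {suc k} (s≤s p) = insert-> {n} {k} p

  ⊢-shift : ∀ k B {Γ t A} → Γ ⊢ t ∶ A → insert k B Γ ⊢ shift k t ∶ A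
  ⊢-shift k B {Γ} (tvar {n} e) with <-cmp n k
  ... | tri< r _ _ rewrite shift-var< r = tvar (trans (insert-< {n} {k} {B} {Γ} r) e)
  ... | tri≈ _ refl _ rewrite shift-var≥ (≤-refl {n}) = tvar (trans (insert-> {n} {n} {B} {Γ} ≤-refl) e)
  ... | tri> _ _ r rewrite shift-var≥ (<⇒≤ r) = tvar (trans (insert-> {n} {k} {B} {Γ} (<⇒≤ r)) e)
  ⊢-shift k B (tlam ar d) = tlam ar (⊢-shift (suc k) B d)
  ⊢-shift k B (tapp ar d e) = tapp ar (⊢-shift k B d) (⊢-shift k B e)

  ⊢-subst : ∀ k {B Γ t s A} → insert k B Γ ⊢ t ∶ A → Γ ⊢ s ∶ B → Γ ⊢ subst k s t ∶ A
  ⊢-subst k {B} {Γ} {s = s} (tvar {n} e) ds with <-cmp n k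
  ... | tri< r _ _ rewrite subst-var< {n} {k} {s} r = tvar (trans (sym (insert-< {n} {k} {B} {Γ} r)) e)
  ... | tri≈ _ refl _ rewrite subst-var≡ {n} {s} | sym e | insert-≡ {n} {B} {Γ} = ds
  ... | tri> _ _ (s≤s {n = m} r) rewrite subst-var> {m} {k} {s} r
    = tvar (trans (sym (insert-> {m} {k} {B} {Γ} r)) e)
  ⊢-subst k (tlam ar d) ds = tlam ar (⊢-subst (suc k) d (⊢-shift 0 _ ds))
  ⊢-subst k (tapp ar d e) ds = tapp ar (⊢-subst k d ds) (⊢-subst k e ds)

  -- Subject reduction; the β case is where uniqueness of arrows is used.
  subject-reduction : ∀ {Γ t t' A} → Γ ⊢ t ∶ A → t →β t' → Γ ⊢ t' ∶ A
  subject-reduction (tapp ar (tlam ar' d) e) β with arrow-unique ar ar'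
  ... | refl , refl = ⊢-subst 0 d e
  subject-reduction (tapp ar d e) (appL p) = tapp ar (subject-reduction d p) e
  subject-reduction (tapp ar d e) (appR p) = tapp ar d (subject-reduction e p)
  subject-reduction (tlam ar d) (lam p) = tlam ar (subject-reduction d p)

  subject-reduction* : ∀ {Γ t t' A} → Γ ⊢ t ∶ A → t ↠ t' → Γ ⊢ t' ∶ A
  subject-reduction* d ε = d
  subject-reduction* d (p ◅ ps) = subject-reduction* (subject-reduction d p) ps

-- The type structure separating B Y₀ S from B Y₀

-- Atoms a and c; every other type has exactly one arrow decomposition:
--   A1 = a → a      Z = c → A1     T = c → a       TT = T → T
--   D = D → T       YT = TT → T    ZTT = Z → TT    σ = Z → T
--   BT1 = ZTT → σ   BT = YT → BT1
-- D types ω_f with f : TT, hence Y₀ : YT; B : BT and S : ZTT.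
data Ty : Set where
  a c A1 Z T TT D YT ZTT σ BT1 BT : Ty

data Arrow : Ty → Ty → Ty → Set where
  aA1  : Arrow A1 a a
  aZ   : Arrow Z c A1
  aT   : Arrow T c a
  aTT  : Arrow TT T T
  aD   : Arrow D D T
  aYT  : Arrow YT TT T
  aZTT : Arrow ZTT Z TT
  aσ   : Arrow σ Z T
  aBT1 : Arrow BT1 ZTT σ
  aBT  : Arrow BT YT BT1

arrow-unique : ∀ {A B C B' C'} → Arrow A B C → Arrow A B' C' → (B ≡ B') × (C ≡ C')
arrow-unique aA1 aA1 = refl , refl
arrow-unique aZ aZ = refl , refl
arrow-unique aT aT = refl , refl
arrow-unique aTT aTT = refl , refl
arrow-unique aD aD = refl , refl
arrow-unique aYT aYT = refl , refl
arrow-unique aZTT aZTT = refl , refl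
arrow-unique aσ aσ = refl , refl
arrow-unique aBT1 aBT1 = refl , refl
arrow-unique aBT aBT = refl , refl

open TypeAssignment Arrow arrow-unique

Γ₀ : Ctx
Γ₀ _ = a

⊢B : Γ₀ ⊢ B ∶ BT
⊢B = tlam aBT (tlam aBT1 (tlam aσ (tapp aYT (tvar refl) (tapp aZTT (tvar refl) (tvar refl)))))

⊢ω : ∀ {Γ} → Γ zero ≡ TT → Γ ⊢ (ƛ var 1 · (var 0 · var 0)) ∶ D
⊢ω f∶TT = tlam aD (tapp aTT (tvar f∶TT) (tapp aD (tvar refl) (tvar refl)))

⊢Y₀ : Γ₀ ⊢ Y₀ ∶ YT
⊢Y₀ = tlam aYT (tapp aD (⊢ω refl) (⊢ω refl))

⊢S : Γ₀ ⊢ S ∶ ZTT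
⊢S = tlam aZTT (tlam aTT (tlam aT (tapp aA1 (tapp aZ (tvar refl) (tvar refl))
                                             (tapp aT (tvar refl) (tvar refl)))))

⊢BY₀S : Γ₀ ⊢ B · Y₀ · S ∶ σ
⊢BY₀S = tapp aBT1 (tapp aBT ⊢B ⊢Y₀) ⊢S

-- The reducts of B Y₀

-- ω_f with f = var 0, and its instance at f = (var 1 · var 0) under λx.
ω₀ ω₁ : Term
ω₀ = ƛ var 1 · (var 0 · var 0)
ω₁ = ƛ (var 2 · var 1) · (var 0 · var 0)

-- Unfoldings f (f (… (ω_f ω_f))) of the body of Y₀, with f = var 0 …
data Unfolding₀ : Term → Set where
  fix₀  : Unfolding₀ (ω₀ · ω₀)
  step₀ : ∀ {t} → Unfolding₀ t → Unfolding₀ (var 0 · t)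

-- … and with f = var 1 · var 0 (i.e. f = y z under λy z).
data Unfolding₁ : Term → Set where
  fix₁  : Unfolding₁ (ω₁ · ω₁)
  step₁ : ∀ {t} → Unfolding₁ t → Unfolding₁ ((var 1 · var 0) · t)

-- The reducts of B Y₀: B (λf. u), then λy z. (λf. u) (y z), then
-- λy z. u[f := y z], where u is an unfolding.
data BY₀-reduct : Term → Set where
  applied   : ∀ {t} → Unfolding₀ t → BY₀-reduct (B · (ƛ t))
  composed  : ∀ {t} → Unfolding₀ t → BY₀-reduct (ƛ ƛ (ƛ t) · (var 1 · var 0))
  unfolded  : ∀ {t} → Unfolding₁ t → BY₀-reduct (ƛ ƛ t)

-- The only redex of an unfolding is ω ω, which unfolds once more.
unfolding₀-step : ∀ {t t'} → Unfolding₀ t → t →β t' → Unfolding₀ t'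
unfolding₀-step fix₀ β = step₀ fix₀
unfolding₀-step fix₀ (appL (lam (appL ())))
unfolding₀-step fix₀ (appL (lam (appR (appL ()))))
unfolding₀-step fix₀ (appL (lam (appR (appR ()))))
unfolding₀-step fix₀ (appR (lam (appL ())))
unfolding₀-step fix₀ (appR (lam (appR (appL ()))))
unfolding₀-step fix₀ (appR (lam (appR (appR ()))))
unfolding₀-step (step₀ u) (appL ())
unfolding₀-step (step₀ u) (appR p) = step₀ (unfolding₀-step u p)

unfolding₁-step : ∀ {t t'} → Unfolding₁ t → t →β t' → Unfolding₁ t'
unfolding₁-step fix₁ β = step₁ fix₁
unfolding₁-step fix₁ (appL (lam (appL (appL ()))))
unfolding₁-step fix₁ (appL (lam (appL (appR ()))))
unfolding₁-step fix₁ (appL (lam (appR (appL ()))))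
unfolding₁-step fix₁ (appL (lam (appR (appR ()))))
unfolding₁-step fix₁ (appR (lam (appL (appL ()))))
unfolding₁-step fix₁ (appR (lam (appL (appR ()))))
unfolding₁-step fix₁ (appR (lam (appR (appL ()))))
unfolding₁-step fix₁ (appR (lam (appR (appR ()))))
unfolding₁-step (step₁ u) (appL (appL ()))
unfolding₁-step (step₁ u) (appL (appR ()))
unfolding₁-step (step₁ u) (appR p) = step₁ (unfolding₁-step u p)

-- Unfoldings do not mention index 1, so shift 1 leaves them unchanged.
unfolding₀-shift : ∀ {t} → Unfolding₀ t → Unfolding₀ (shift 1 t)
unfolding₀-shift fix₀ = fix₀
unfolding₀-shift (step₀ u) = step₀ (unfolding₀-shift u)

unfolding₀-subst : ∀ {t} → Unfolding₀ t → Unfolding₁ (subst 0 (var 1 · var 0) t)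
unfolding₀-subst fix₀ = fix₁
unfolding₀-subst (step₀ u) = step₁ (unfolding₀-subst u)

BY₀-reduct-step : ∀ {t t'} → BY₀-reduct t → t →β t' → BY₀-reduct t'
BY₀-reduct-step (applied u) β = composed (unfolding₀-shift (unfolding₀-shift u))
BY₀-reduct-step (applied u) (appL (lam (lam (lam (appL ())))))
BY₀-reduct-step (applied u) (appL (lam (lam (lam (appR (appL ()))))))
BY₀-reduct-step (applied u) (appL (lam (lam (lam (appR (appR ()))))))
BY₀-reduct-step (applied u) (appR (lam p)) = applied (unfolding₀-step u p)
BY₀-reduct-step (composed u) (lam (lam β)) = unfolded (unfolding₀-subst u)
BY₀-reduct-step (composed u) (lam (lam (appL (lam p)))) = composed (unfolding₀-step u p)
BY₀-reduct-step (composed u) (lam (lam (appR (appL ()))))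
BY₀-reduct-step (composed u) (lam (lam (appR (appR ()))))
BY₀-reduct-step (unfolded u) (lam (lam p)) = unfolded (unfolding₁-step u p)

BY₀-reduct-closed : ∀ {t t'} → BY₀-reduct t → t ↠ t' → BY₀-reduct t'
BY₀-reduct-closed r ε = r
BY₀-reduct-closed r (p ◅ ps) = BY₀-reduct-closed (BY₀-reduct-step r p) ps

-- With y : Z and z : c, an unfolding cannot have type a: y z keeps type
-- a → a, and ω₁ ω₁ would need the λ-term ω₁ to have the atomic type a or c.
unfolding₁-untypable : ∀ {Γ t} → Unfolding₁ t → ¬ (Γ ,, Z ,, c ⊢ t ∶ a)
unfolding₁-untypable fix₁ (tapp aA1 _ (tlam () _))
unfolding₁-untypable fix₁ (tapp aT _ (tlam () _))
unfolding₁-untypable (step₁ u) (tapp ar (tapp ar' (tvar refl) (tvar refl)) d) with ar'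
... | aZ with ar
...   | aA1 = unfolding₁-untypable u d

BY₀-reduct-untypable : ∀ {Γ t} → BY₀-reduct t → ¬ (Γ ⊢ t ∶ σ)
BY₀-reduct-untypable (applied u)
  (tapp aBT1 (tlam aBT1 (tlam aσ (tlam aT (tapp ar (tvar refl) (tapp aZ (tvar refl) (tvar refl)))))) _)
  with ar
... | ()
BY₀-reduct-untypable (composed u) (tlam aσ (tlam aT (tapp ar _ (tapp aZ (tvar refl) (tvar refl)))))
  with ar
... | ()
BY₀-reduct-untypable (unfolded u) (tlam aσ (tlam aT d)) = unfolding₁-untypable u d

proposition11 : ¬ (B · Y₀ =β B · Y₀ · S)
proposition11 conv with church-rosser conv
... | w , BY₀↠w , BY₀S↠w =
  BY₀-reduct-untypable (BY₀-reduct-closed (applied fix₀) BY₀↠w)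
                       (subject-reduction* ⊢BY₀S BY₀S↠w)
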